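{- $\mathrm{SLT}_1\subsetneq\mathrm{REG}_5^Z$.
   Context: For $k\geq1$, a language $L$ over an alphabet $V$ is strictly locally $k$-testable (family $\mathrm{SLT}_k$) if there are sets $B,I,E\subseteq V^k$ and a finite set $F$ of words of length at most $k-1$ such that $L$ consists of the words of $F$ together with exactly those words $a_1a_2\cdots a_n$ ($n\geq k$, $a_i\in V$) for which $a_1\cdots a_k\in B$, $a_{j+1}\cdots a_{j+k}\in I$ for every $j$ with $1\leq j\leq n-k-1$, and $a_{n-k+1}\cdots a_n\in E$. $\mathrm{REG}_n^Z$ is the family of regular languages accepted by some deterministic finite automaton (with total transition function) with at most $n$ states. -}

module Defs where

open import Data.Nat using (ℕ; suc; _≤_; _<_; _∸_; _+_)
open import Data.Fin using (Fin)
open import Data.Bool using (Bool; true)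
open import Data.List using (List; length; take; drop; foldl)
open import Data.Product using (Σ; _×_; ∃-syntax)
open import Data.Sum using (_⊎_)
open import Relation.Binary.PropositionalEquality using (_≡_)
open import Function.Bundles using (_⇔_)

Language : Set → Set₁
Language V = List V → Set

-- Membership in the strictly locally k-testable language determined by
-- B, I, E ⊆ V^k (decidable subsets, given as Boolean predicates on words;
-- only their values on words of length k matter) and F (only its values on
-- words of length ≤ k-1 matter, so F is effectively a set of such words).
InSLT : {V : Set} (k : ℕ) (B I E F : List V → Bool) → List V → Set
InSLT k B I E F w =
  (length w < k × F w ≡ true)
  ⊎ (k ≤ length w
     × B (take k w) ≡ true
     × (∀ j → 1 ≤ j → j + k + 1 ≤ length w → I (take k (drop j w)) ≡ true)
     × E (drop (length w ∸ k) w) ≡ true)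

IsSLT : {V : Set} → ℕ → Language V → Set
IsSLT {V} k L =
  ∃[ B ] ∃[ I ] ∃[ E ] ∃[ F ] (∀ (w : List V) → L w ⇔ InSLT k B I E F w)

record DFA (V : Set) (n : ℕ) : Set where
  field
    start     : Fin n
    δ         : Fin n → V → Fin n
    accepting : Fin n → Bool

  run : Fin n → List V → Fin n
  run = foldl δ

  Accepts : List V → Set
  Accepts w = accepting (run start w) ≡ true

IsREGZ : {V : Set} → ℕ → Language V → Set
IsREGZ {V} n L =
  ∃[ m ] (m ≤ n × Σ (DFA V m) λ A → ∀ (w : List V) → L w ⇔ DFA.Accepts A w)

{-# OPTIONS --safe #-}
-- Over a one-letter window, membership only depends on the first letter, the
-- last letter and the letters in between, so a DFA only has to remember
-- whether the letter just read may be followed by further letters (it lies in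
-- I) and whether the word may end here (it lies in E).  With a start state,
-- and the dead state doubling as the pair (no, no), five states suffice.
-- Conversely SLT₁ cannot count: if a single letter a is accepted, then a is
-- in B and in E, so aa is accepted too; the words of length one, recognised
-- by a three-state counter, therefore form a language in REG₅ outside SLT₁.
module Submission where

open import Defs
open import Data.Nat using (ℕ; suc; zero; _≤_; _+_; z≤n; s≤s)
open import Data.Nat.Properties using (≤-refl; m≤m+n)
open import Data.Fin using (Fin; zero; suc)
open import Data.Bool using (Bool; true; false; _∧_; if_then_else_)
open import Data.List using (List; []; _∷_; length; take; drop)
open import Data.Product using (_×_; ∃-syntax; _,_; proj₂; uncurry)
open import Data.Sum using (inj₁; inj₂)
open import Relation.Nullary using (¬_)
open import Relation.Binary.PropositionalEquality using (_≡_; refl)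
open import Function.Bundles using (_⇔_; mk⇔; Equivalence)
open import Function.Construct.Composition using (_⇔-∘_)

open Equivalence using (to; from)

∧-≡-true : ∀ {x y} → x ∧ y ≡ true ⇔ (x ≡ true × y ≡ true)
∧-≡-true {true} = mk⇔ (λ p → refl , p) proj₂
∧-≡-true {false} = mk⇔ (λ ()) (λ ())

run-absorbing : ∀ {V n} (A : DFA V n) {s : Fin n} →
                (∀ a → DFA.δ A s a ≡ s) → ∀ w → DFA.run A s w ≡ s
run-absorbing A fixed [] = refl
run-absorbing A fixed (a ∷ w) rewrite fixed a = run-absorbing A fixed w

module SLT₁Automaton {V : Set} (B I E F : List V → Bool) where

  b i e : V → Bool
  b a = B (a ∷ [])
  i a = I (a ∷ [])
  e a = E (a ∷ [])

  InteriorIn AllButLastIn : List V → Set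
  InteriorIn w = ∀ j → 1 ≤ j → j + 1 + 1 ≤ length w → I (take 1 (drop j w)) ≡ true
  AllButLastIn w = ∀ j → j + 1 + 1 ≤ length w → I (take 1 (drop j w)) ≡ true

  interior-∷ : ∀ a v → InteriorIn (a ∷ v) ⇔ AllButLastIn v
  interior-∷ a v = mk⇔
    (λ int j q → int (suc j) (s≤s z≤n) (s≤s q))
    (λ { al zero () ; al (suc j) _ (s≤s q) → al j q })

  allButLast-∷ : ∀ c d w → AllButLastIn (c ∷ d ∷ w) ⇔ (i c ≡ true × AllButLastIn (d ∷ w))
  allButLast-∷ c d w = mk⇔
    (λ al → al zero (s≤s (s≤s z≤n)) , λ j q → al (suc j) (s≤s q))
    (λ { (ic , al) zero _ → ic ; (ic , al) (suc j) (s≤s q) → al j q })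

  -- Acceptance of the rest w of the input, when the letter read last
  -- lies in I iff x and in E iff y.
  continue : Bool → Bool → List V → Bool
  continue x y [] = y
  continue x y (c ∷ w) = x ∧ continue (i c) (e c) w

  slt₁ : List V → Bool
  slt₁ [] = F []
  slt₁ (a ∷ v) = b a ∧ continue true (e a) v

  continue-sound : ∀ c v → continue (i c) (e c) v ≡ true →
                   AllButLastIn (c ∷ v) × E (drop (length v) (c ∷ v)) ≡ true
  continue-sound c [] p =
    (λ { zero (s≤s ()) ; (suc zero) (s≤s ()) ; (suc (suc j)) (s≤s ()) }) , p
  continue-sound c (d ∷ w) p =
    let ic , q = to ∧-≡-true p
        al , last = continue-sound d w q
    in from (allButLast-∷ c d w) (ic , al) , last

  continue-complete : ∀ c v → AllButLastIn (c ∷ v) → E (drop (length v) (c ∷ v)) ≡ true →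
                      continue (i c) (e c) v ≡ true
  continue-complete c [] _ last = last
  continue-complete c (d ∷ w) al last =
    let ic , al′ = to (allButLast-∷ c d w) al
    in from ∧-≡-true (ic , continue-complete d w al′ last)

  continue-after-first : ∀ a v → continue true (e a) v ≡ true ⇔
                         (AllButLastIn v × E (drop (length v) (a ∷ v)) ≡ true)
  continue-after-first a [] = mk⇔ (λ p → (λ { zero () ; (suc j) () }) , p) proj₂
  continue-after-first a (c ∷ w) = mk⇔ (continue-sound c w) (uncurry (continue-complete c w))

  InSLT₁⇔slt₁ : ∀ w → InSLT 1 B I E F w ⇔ slt₁ w ≡ true
  InSLT₁⇔slt₁ [] = mk⇔ (λ { (inj₁ (_ , p)) → p ; (inj₂ (() , _)) }) (λ p → inj₁ (s≤s z≤n , p))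
  InSLT₁⇔slt₁ (a ∷ v) = mk⇔ sound complete
    where
    sound : InSLT 1 B I E F (a ∷ v) → slt₁ (a ∷ v) ≡ true
    sound (inj₁ (s≤s () , _))
    sound (inj₂ (_ , ba , int , last)) =
      from ∧-≡-true (ba , from (continue-after-first a v) (to (interior-∷ a v) int , last))
    complete : slt₁ (a ∷ v) ≡ true → InSLT 1 B I E F (a ∷ v)
    complete p =
      let ba , q = to ∧-≡-true p
          al , last = to (continue-after-first a v) q
      in inj₂ (s≤s z≤n , ba , from (interior-∷ a v) al , last)

  dead : Fin 5
  dead = suc zero

  alive : Bool → Bool → Fin 5
  alive true true = suc (suc zero)
  alive true false = suc (suc (suc zero))
  alive false true = suc (suc (suc (suc zero)))
  alive false false = dead

  step : Fin 5 → V → Fin 5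
  step zero a = if b a then alive true (e a) else dead
  step (suc zero) _ = dead
  step (suc (suc zero)) c = alive (i c) (e c)
  step (suc (suc (suc zero))) c = alive (i c) (e c)
  step (suc (suc (suc (suc zero)))) _ = dead

  accepting : Fin 5 → Bool
  accepting zero = F []
  accepting (suc zero) = false
  accepting (suc (suc zero)) = true
  accepting (suc (suc (suc zero))) = false
  accepting (suc (suc (suc (suc zero)))) = true

  automaton : DFA V 5
  automaton = record { start = zero ; δ = step ; accepting = accepting }

  open DFA automaton using (run)

  accepting-alive : ∀ x y → accepting (alive x y) ≡ y
  accepting-alive true true = refl
  accepting-alive true false = refl
  accepting-alive false true = refl
  accepting-alive false false = refl

  step-alive : ∀ x y c → step (alive x y) c ≡ (if x then alive (i c) (e c) else dead)
  step-alive true true c = refl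
  step-alive true false c = refl
  step-alive false true c = refl
  step-alive false false c = refl

  run-dead : ∀ w → run dead w ≡ dead
  run-dead = run-absorbing automaton (λ _ → refl)

  run-alive : ∀ x y w → accepting (run (alive x y) w) ≡ continue x y w
  run-alive x y [] = accepting-alive x y
  run-alive true y (c ∷ w) rewrite step-alive true y c = run-alive (i c) (e c) w
  run-alive false y (c ∷ w) rewrite step-alive false y c | run-dead w = refl

  run-start : ∀ w → accepting (run zero w) ≡ slt₁ w
  run-start [] = refl
  run-start (a ∷ v) with b a
  ... | true = run-alive true (e a) v
  ... | false rewrite run-dead v = refl

  InSLT₁⇔accepts : ∀ w → InSLT 1 B I E F w ⇔ DFA.Accepts automaton w
  InSLT₁⇔accepts w rewrite run-start w = InSLT₁⇔slt₁ w

SLT₁⊆REG₅ : ∀ {V} (L : Language V) → IsSLT 1 L → IsREGZ 5 L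
SLT₁⊆REG₅ L (B , I , E , F , L⇔) = 5 , ≤-refl , automaton , λ w → InSLT₁⇔accepts w ⇔-∘ L⇔ w
  where open SLT₁Automaton B I E F

InSLT₁-single⇒double : ∀ {V} (B I E F : List V → Bool) a →
                       InSLT 1 B I E F (a ∷ []) → InSLT 1 B I E F (a ∷ a ∷ [])
InSLT₁-single⇒double B I E F a (inj₁ (s≤s () , _))
InSLT₁-single⇒double B I E F a (inj₂ (_ , ba , _ , ea)) = inj₂ (s≤s z≤n , ba , no-interior , ea)
  where
  no-interior : ∀ j → 1 ≤ j → j + 1 + 1 ≤ 2 → I (take 1 (drop j (a ∷ a ∷ []))) ≡ true
  no-interior zero ()
  no-interior (suc zero) _ (s≤s (s≤s ()))
  no-interior (suc (suc zero)) _ (s≤s (s≤s ()))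
  no-interior (suc (suc (suc j))) _ (s≤s (s≤s ()))

LengthOne : {V : Set} → Language V
LengthOne w = length w ≡ 1

counter : ∀ {V} → DFA V 3
counter = record { start = zero ; δ = tick ; accepting = is-one }
  where
  tick : Fin 3 → _ → Fin 3
  tick zero _ = suc zero
  tick (suc _) _ = suc (suc zero)
  is-one : Fin 3 → Bool
  is-one (suc zero) = true
  is-one _ = false

LengthOne⇔counter : ∀ {V} (w : List V) → LengthOne w ⇔ DFA.Accepts counter w
LengthOne⇔counter [] = mk⇔ (λ ()) (λ ())
LengthOne⇔counter (a ∷ []) = mk⇔ (λ _ → refl) (λ _ → refl)
LengthOne⇔counter (a ∷ b ∷ w) rewrite run-absorbing counter {suc (suc zero)} (λ _ → refl) w =
  mk⇔ (λ ()) (λ ())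

LengthOne-not-SLT₁ : ∀ {V} → V → ¬ IsSLT 1 (LengthOne {V})
LengthOne-not-SLT₁ a (B , I , E , F , L⇔)
  with from (L⇔ (a ∷ a ∷ [])) (InSLT₁-single⇒double B I E F a (to (L⇔ (a ∷ [])) refl))
... | ()

lemma10 : ∀ (m : ℕ) →
              ((L : Language (Fin (suc m))) → IsSLT 1 L → IsREGZ 5 L)
              × (∃[ L ] (IsREGZ {Fin (suc m)} 5 L × ¬ IsSLT 1 L))
lemma10 m =
  SLT₁⊆REG₅ ,
  LengthOne , (3 , m≤m+n 3 2 , counter , LengthOne⇔counter) , LengthOne-not-SLT₁ zero
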